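{- Let $\mathbf{k}$ be a commutative ring, let $(R,P)$ be a commutative nonunitary Rota–Baxter $\mathbf{k}$-algebra of weight $0$, and let $f:Ш(x\mathbf{k}[x])^0\to R$ be a $\mathbf{k}$-linear map such that (1) $f(x\cdot y)=f(x)f(y)$ for all $y\in Ш(x\mathbf{k}[x])^0$, and (2) $f(P_x(y))=P(f(y))$ for all $y\in Ш(x\mathbf{k}[x])^0$. Then $f$ is a homomorphism of nonunitary Rota–Baxter algebras.
   Context: A nonunitary Rota–Baxter $\mathbf{k}$-algebra of weight $0$ is a (not necessarily unital) $\mathbf{k}$-algebra $R$ with linear $P:R\to R$ such that $P(a)P(b)=P(aP(b))+P(P(a)b)$; a homomorphism is an algebra homomorphism commuting with the operators. Let $Ш(\mathbf{k}[x])$ be the $\mathbf{k}$-module $\bigoplus_{k\ge1}\mathbf{k}[x]^{\otimes k}$ with the product $(a_0\otimes a_1\otimes\cdots\otimes a_m)\cdot(b_0\otimes b_1\otimes\cdots\otimes b_n)=a_0b_0\otimes\big((a_1\otimes\cdots\otimes a_m)\sqcup\!\sqcup(b_1\otimes\cdots\otimes b_n)\big)$, where $\sqcup\!\sqcup$ is the shuffle product of tensors (sum of all interleavings preserving the orders of the $a_i$ and of the $b_j$, with the empty tensor as unit), and with the operator $P_x(\mathfrak a)=1\otimes\mathfrak a$; this is the free commutative Rota–Baxter algebra of weight $0$ on $\mathbf{k}[x]$. Let $Ш(x\mathbf{k}[x])^0$ be the submodule spanned by the pure tensors $x^{n_1}\otimes\cdots\otimes x^{n_k}$ with $k\ge1$,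 $n_i\ge0$ and $n_k\ge1$; with the restricted product and operator $P_x$ it is the free commutative nonunitary Rota–Baxter algebra of weight $0$ generated by $x$ (here $x$ denotes the tensor of length one $x\in\mathbf{k}[x]$). -}

module Defs where

open import Level using (Level; _⊔_) renaming (suc to lsuc)
open import Algebra.Bundles using (CommutativeRing)
open import Algebra.Module.Bundles using (Module)
open import Data.Nat using (ℕ; zero; suc) renaming (_+_ to _+ℕ_)
open import Data.List using (List; []; _∷_; _++_; map; concatMap; [_])
open import Data.Product using (_×_; _,_; proj₁; proj₂)
import Data.List.Properties as LP
import Data.Product.Properties as PP
import Data.Nat.Properties as NP
open import Data.Bool using (if_then_else_)
open import Relation.Nullary using (does)
open import Relation.Binary.PropositionalEquality using (_≡_)
open import Relation.Binary.Definitions using (DecidableEquality)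

record NUCommAlgebra {c ℓ} (K : CommutativeRing c ℓ) (m ℓm : Level)
       : Set (c ⊔ ℓ ⊔ lsuc (m ⊔ ℓm)) where
  field
    module′ : Module K m ℓm
  open Module module′ public
  infixl 7 _*_
  field
    _*_        : Carrierᴹ → Carrierᴹ → Carrierᴹ
    *-cong     : ∀ {a a′ b b′} → a ≈ᴹ a′ → b ≈ᴹ b′ → (a * b) ≈ᴹ (a′ * b′)
    *-assoc    : ∀ a b d → ((a * b) * d) ≈ᴹ (a * (b * d))
    *-comm     : ∀ a b → (a * b) ≈ᴹ (b * a)
    *-distribʳ : ∀ a b d → ((a +ᴹ b) * d) ≈ᴹ ((a * d) +ᴹ (b * d))
    *ₗ-*       : ∀ (k : CommutativeRing.Carrier K) a b → ((k *ₗ a) * b) ≈ᴹ (k *ₗ (a * b))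

record RBAlgebra {c ℓ} (K : CommutativeRing c ℓ) (m ℓm : Level)
       : Set (c ⊔ ℓ ⊔ lsuc (m ⊔ ℓm)) where
  field
    algebra : NUCommAlgebra K m ℓm
  open NUCommAlgebra algebra public
  field
    P      : Carrierᴹ → Carrierᴹ
    P-cong : ∀ {a b} → a ≈ᴹ b → P a ≈ᴹ P b
    P-+    : ∀ a b → P (a +ᴹ b) ≈ᴹ (P a +ᴹ P b)
    P-*ₗ   : ∀ (k : CommutativeRing.Carrier K) a → P (k *ₗ a) ≈ᴹ (k *ₗ P a)
    P-RB   : ∀ a b → (P a * P b) ≈ᴹ (P (a * P b) +ᴹ P (P a * b))

-- Basis of Ш(x k[x])^0: pure tensors x^{n_1} ⊗ ⋯ ⊗ x^{n_k}, k ≥ 1, n_k ≥ 1.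
-- Encoded bijectively as (ns , m) ↦ x^{ns_1} ⊗ ⋯ ⊗ x^{ns_j} ⊗ x^{suc m}.

Word : Set
Word = List ℕ × ℕ

_≟W_ : DecidableEquality Word
_≟W_ = PP.≡-dec (LP.≡-dec NP._≟_) NP._≟_

consW : ℕ → Word → Word
consW a (ws , k) = (a ∷ ws , k)

-- shuffle (with multiplicity) of the words (us , m) and (vs , n)
shW : List ℕ → ℕ → List ℕ → ℕ → List Word
shW [] m [] n = (suc m ∷ [] , n) ∷ (suc n ∷ [] , m) ∷ []
shW [] m (b ∷ vs) n = (suc m ∷ b ∷ vs , n) ∷ map (consW b) (shW [] m vs n)
shW (a ∷ us) m [] n = (suc n ∷ a ∷ us , m) ∷ map (consW a) (shW us m [] n)
shW (a ∷ us) m (b ∷ vs) n =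
  map (consW a) (shW us m (b ∷ vs) n) ++ map (consW b) (shW (a ∷ us) m vs n)

-- product of basis tensors:
-- (a₀ ⊗ a') · (b₀ ⊗ b') = a₀b₀ ⊗ (a' ш b'), as a list of words (with multiplicity)
mulW : Word → Word → List Word
mulW ([] , m)     ([] , n)     = ([] , m +ℕ suc n) ∷ []
mulW ([] , m)     (b ∷ bs , n) = (suc m +ℕ b ∷ bs , n) ∷ []
mulW (a ∷ as , m) ([] , n)     = (a +ℕ suc n ∷ as , m) ∷ []
mulW (a ∷ as , m) (b ∷ bs , n) = map (consW (a +ℕ b)) (shW as m bs n)

-- P_x on basis tensors: w ↦ 1 ⊗ w = x^0 ⊗ w
PxW : Word → Word
PxW (ws , k) = (0 ∷ ws , k)

xW : Word
xW = ([] , 0)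

-- The free k-module on Word: finite formal linear combinations, modulo
-- equality of all coefficients.

module Sha {c ℓ} (K : CommutativeRing c ℓ) where
  open CommutativeRing K

  Ш : Set c
  Ш = List (Carrier × Word)

  coeff : Ш → Word → Carrier
  coeff [] w = 0#
  coeff ((a , u) ∷ e) w = (if does (u ≟W w) then a else 0#) + coeff e w

  infix 4 _≈Ш_
  _≈Ш_ : Ш → Ш → Set ℓ
  e ≈Ш e′ = ∀ w → coeff e w ≈ coeff e′ w

  infixl 6 _+Ш_
  _+Ш_ : Ш → Ш → Ш
  _+Ш_ = _++_

  infixr 7 _•Ш_
  _•Ш_ : Carrier → Ш → Ш
  k •Ш e = map (λ p → (k * proj₁ p , proj₂ p)) e

  infixl 7 _·Ш_
  _·Ш_ : Ш → Ш → Ш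
  e ·Ш e′ = concatMap (λ p → concatMap (λ q →
              map (λ w → (proj₁ p * proj₁ q , w)) (mulW (proj₂ p) (proj₂ q))) e′) e

  Px : Ш → Ш
  Px e = map (λ p → (proj₁ p , PxW (proj₂ p))) e

  xШ : Ш
  xШ = [ (1# , xW) ]

  module _ {m ℓm} (R : RBAlgebra K m ℓm) where
    open RBAlgebra R using (Carrierᴹ; _≈ᴹ_; _+ᴹ_; _*ₗ_) renaming (_*_ to _*ᴿ_; P to Pᴿ)

    record IsLinear (f : Ш → Carrierᴹ) : Set (c ⊔ ℓ ⊔ ℓm) where
      field
        cong     : ∀ e e′ → e ≈Ш e′ → f e ≈ᴹ f e′
        additive : ∀ e e′ → f (e +Ш e′) ≈ᴹ (f e +ᴹ f e′)
        homog    : ∀ k e → f (k •Ш e) ≈ᴹ (k *ₗ f e)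

    record IsRBHom (f : Ш → Carrierᴹ) : Set (c ⊔ ℓ ⊔ ℓm) where
      field
        linear : IsLinear f
        mult   : ∀ y z → f (y ·Ш z) ≈ᴹ (f y *ᴿ f z)
        comm-P : ∀ y → f (Px y) ≈ᴹ Pᴿ (f y)

module Submission where

-- Only multiplicativity f(y·z) = f(y)f(z) needs proof.  The argument has three
-- layers.
--   1. Combinatorics of basis words: every word is generated from x by the
--      operations w ↦ x·w and w ↦ P_x(w); the product of words is compatible
--      with x·_ on either side; and the shuffle product satisfies the
--      Rota–Baxter identity P_x(u)·P_x(v) = P_x(u·P_x v) + P_x(P_x u·v)
--      as multisets of words (lists up to permutation).
--   2. Linear extension: a linear f is determined by its values φ(w) on basis
--      words, and f is multiplicative as soon as φ(u)φ(v) equals the sum of φ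
--      over the word product u·v.
--   3. Basis multiplicativity, by induction on how the left (and, in the
--      P_x-case, the right) word is generated: x·_ is handled by hypothesis
--      (1), two P_x-words by the shuffle identity, hypothesis (2) and the
--      Rota–Baxter identity in R.

open import Defs
open import Algebra.Bundles using (CommutativeRing)
open import Data.Nat using (zero; suc)
import Data.Nat.Properties as NP
open import Data.List using (List; []; _∷_; _++_; map; concatMap; [_])
import Data.List.Properties as LP
open import Data.Product using (_,_; proj₁; proj₂)
open import Data.Bool using (true; false)
open import Relation.Nullary using (does)
open import Relation.Binary.PropositionalEquality as Eq using (_≡_; refl)
open import Data.List.Relation.Binary.Permutation.Propositional as ↭
  using (_↭_; ↭-refl; ↭-reflexive)
import Data.List.Relation.Binary.Permutation.Propositional.Properties as ↭-Props
import Relation.Binary.Reasoning.Setoid as SetoidReasoning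

-- the basis word x·w (multiplication by the generator raises the first power)
xmul : Word → Word
xmul ([] , n)     = ([] , suc n)
xmul (b ∷ bs , n) = (suc b ∷ bs , n)

-- Words as generated from x by x·_ and P_x; this is the induction principle
-- behind the proof that f is multiplicative on basis words.
data Generated : Word → Set where
  gen-x : Generated xW
  gen-· : ∀ {w} → Generated w → Generated (xmul w)
  gen-P : ∀ {w} → Generated w → Generated (PxW w)

generated-power : ∀ n → Generated ([] , n)
generated-power zero    = gen-x
generated-power (suc n) = gen-· (generated-power n)

-- x^a ⊗ w′ = x·⋯·x·P_x(w′), by mutual recursion on the exponents
generated-cons : ∀ a as m → Generated (a ∷ as , m)
generated-list : ∀ as m → Generated (as , m)
generated-cons zero    as m = gen-P (generated-list as m)
generated-cons (suc a) as m = gen-· (generated-cons a as m)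
generated-list []       m = generated-power m
generated-list (a ∷ as) m = generated-cons a as m

generated : ∀ w → Generated w
generated (as , m) = generated-list as m

mulW-x-left : ∀ v → mulW xW v ≡ [ xmul v ]
mulW-x-left ([] , n)     = refl
mulW-x-left (b ∷ bs , n) = refl

mulW-xmul-left : ∀ u v → mulW (xmul u) v ≡ map xmul (mulW u v)
mulW-xmul-left ([] , m)     ([] , n)     = refl
mulW-xmul-left ([] , m)     (b ∷ bs , n) = refl
mulW-xmul-left (a ∷ as , m) ([] , n)     = refl
mulW-xmul-left (a ∷ as , m) (b ∷ bs , n) = LP.map-∘ (shW as m bs n)

mulW-xmul-right : ∀ u v → mulW u (xmul v) ≡ map xmul (mulW u v)
mulW-xmul-right ([] , m) ([] , n) =
  Eq.cong (λ k → [ ([] , k) ]) (NP.+-suc m (suc n))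
mulW-xmul-right ([] , m) (b ∷ bs , n) =
  Eq.cong (λ k → [ (suc k ∷ bs , n) ]) (NP.+-suc m b)
mulW-xmul-right (a ∷ as , m) ([] , n) =
  Eq.cong (λ k → [ (k ∷ as , m) ]) (NP.+-suc a (suc n))
mulW-xmul-right (a ∷ as , m) (b ∷ bs , n) rewrite NP.+-suc a b =
  LP.map-∘ (shW as m bs n)

mulW-x-right-P : ∀ u → mulW (PxW u) xW ≡ [ xmul (PxW u) ]
mulW-x-right-P (as , m) = refl

-- The Rota–Baxter identity of weight 0 for the shuffle product on basis
-- words, as an equality of multisets of words: split the shuffles by which
-- word contributes the first letter.
mulW-RB : ∀ u v → mulW (PxW u) (PxW v)
                ↭ map PxW (mulW u (PxW v)) ++ map PxW (mulW (PxW u) v)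
mulW-RB ([] , m)     ([] , n)     rewrite NP.+-identityʳ m = ↭-refl
mulW-RB ([] , m)     (b ∷ vs , n) rewrite NP.+-identityʳ m = ↭-refl
mulW-RB (a ∷ us , m) ([] , n)     rewrite NP.+-identityʳ a =
  ↭-Props.++-comm [ (0 ∷ suc n ∷ a ∷ us , m) ] (map PxW (map (consW a) (shW us m [] n)))
mulW-RB (a ∷ us , m) (b ∷ vs , n) rewrite NP.+-identityʳ a =
  ↭-reflexive (LP.map-++ PxW (map (consW a) (shW us m (b ∷ vs) n))
                             (map (consW b) (shW (a ∷ us) m vs n)))

module AlgebraProperties {c ℓ m ℓm} {K : CommutativeRing c ℓ}
                         (A : NUCommAlgebra K m ℓm) where
  open NUCommAlgebra A
  open CommutativeRing K using (0#) renaming (refl to K-refl)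
  open SetoidReasoning ≈ᴹ-setoid

  zero-* : ∀ d → (0ᴹ * d) ≈ᴹ 0ᴹ
  zero-* d = begin
    0ᴹ * d          ≈⟨ *-cong (*ₗ-zeroˡ 0ᴹ) ≈ᴹ-refl ⟨
    (0# *ₗ 0ᴹ) * d  ≈⟨ *ₗ-* 0# 0ᴹ d ⟩
    0# *ₗ (0ᴹ * d)  ≈⟨ *ₗ-zeroˡ _ ⟩
    0ᴹ              ∎

  *-zero : ∀ d → (d * 0ᴹ) ≈ᴹ 0ᴹ
  *-zero d = ≈ᴹ-trans (*-comm d 0ᴹ) (zero-* d)

  *-distribˡ : ∀ d a b → (d * (a +ᴹ b)) ≈ᴹ ((d * a) +ᴹ (d * b))
  *-distribˡ d a b = begin
    d * (a +ᴹ b)     ≈⟨ *-comm _ _ ⟩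
    (a +ᴹ b) * d     ≈⟨ *-distribʳ _ _ _ ⟩
    a * d +ᴹ b * d   ≈⟨ +ᴹ-cong (*-comm _ _) (*-comm _ _) ⟩
    d * a +ᴹ d * b   ∎

  *-*ₗ : ∀ k d a → (d * (k *ₗ a)) ≈ᴹ (k *ₗ (d * a))
  *-*ₗ k d a = begin
    d * (k *ₗ a)   ≈⟨ *-comm _ _ ⟩
    (k *ₗ a) * d   ≈⟨ *ₗ-* _ _ _ ⟩
    k *ₗ (a * d)   ≈⟨ *ₗ-cong K-refl (*-comm _ _) ⟩
    k *ₗ (d * a)   ∎

module RBProperties {c ℓ m ℓm} {K : CommutativeRing c ℓ}
                    (R : RBAlgebra K m ℓm) where
  open RBAlgebra R
  open CommutativeRing K using (0#)

  P-zero : P 0ᴹ ≈ᴹ 0ᴹ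
  P-zero = ≈ᴹ-trans (P-cong (≈ᴹ-sym (*ₗ-zeroˡ 0ᴹ)))
             (≈ᴹ-trans (P-*ₗ 0# 0ᴹ) (*ₗ-zeroˡ _))

module LinearExtension {c ℓ m ℓm} (K : CommutativeRing c ℓ) (R : RBAlgebra K m ℓm)
                       (f : Sha.Ш K → RBAlgebra.Carrierᴹ R)
                       (lin : Sha.IsLinear K R f) where
  open Sha K
  open RBAlgebra R
  open AlgebraProperties algebra
  open CommutativeRing K using (Carrier; 0#; 1#)
    renaming (_*_ to _*K_; refl to K-refl; sym to K-sym; +-congʳ to K-+-congʳ;
              *-identityʳ to K-*-identityʳ)
  open Sha.IsLinear lin
  open SetoidReasoning ≈ᴹ-setoid

  basis : Word → Ш
  basis w = [ (1# , w) ]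

  φ : Word → Carrierᴹ
  φ w = f (basis w)

  Σφ : List Word → Carrierᴹ
  Σφ []       = 0ᴹ
  Σφ (w ∷ ws) = φ w +ᴹ Σφ ws

  Lφ : Ш → Carrierᴹ
  Lφ []             = 0ᴹ
  Lφ ((k , w) ∷ e) = (k *ₗ φ w) +ᴹ Lφ e

  Σφ-++ : ∀ us vs → Σφ (us ++ vs) ≈ᴹ (Σφ us +ᴹ Σφ vs)
  Σφ-++ []       vs = ≈ᴹ-sym (+ᴹ-identityˡ _)
  Σφ-++ (u ∷ us) vs = ≈ᴹ-trans (+ᴹ-congˡ (Σφ-++ us vs)) (≈ᴹ-sym (+ᴹ-assoc _ _ _))

  Σφ-↭ : ∀ {us vs} → us ↭ vs → Σφ us ≈ᴹ Σφ vs
  Σφ-↭ ↭.refl                   = ≈ᴹ-refl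
  Σφ-↭ (↭.prep w p)             = +ᴹ-congˡ (Σφ-↭ p)
  Σφ-↭ (↭.swap {us} {vs} u v p) = begin
    φ u +ᴹ (φ v +ᴹ Σφ us)   ≈⟨ +ᴹ-assoc _ _ _ ⟨
    (φ u +ᴹ φ v) +ᴹ Σφ us   ≈⟨ +ᴹ-cong (+ᴹ-comm _ _) (Σφ-↭ p) ⟩
    (φ v +ᴹ φ u) +ᴹ Σφ vs   ≈⟨ +ᴹ-assoc _ _ _ ⟩
    φ v +ᴹ (φ u +ᴹ Σφ vs)   ∎
  Σφ-↭ (↭.trans p q)            = ≈ᴹ-trans (Σφ-↭ p) (Σφ-↭ q)

  Σφ-singleton : ∀ w → Σφ [ w ] ≈ᴹ φ w
  Σφ-singleton w = +ᴹ-identityʳ _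

  Lφ-++ : ∀ e e′ → Lφ (e ++ e′) ≈ᴹ (Lφ e +ᴹ Lφ e′)
  Lφ-++ []            e′ = ≈ᴹ-sym (+ᴹ-identityˡ _)
  Lφ-++ ((k , w) ∷ e) e′ = ≈ᴹ-trans (+ᴹ-congˡ (Lφ-++ e e′)) (≈ᴹ-sym (+ᴹ-assoc _ _ _))

  Lφ-scaled : ∀ k ws → Lφ (map (λ w → (k , w)) ws) ≈ᴹ (k *ₗ Σφ ws)
  Lφ-scaled k []       = ≈ᴹ-sym (*ₗ-zeroʳ k)
  Lφ-scaled k (w ∷ ws) = ≈ᴹ-trans (+ᴹ-congˡ (Lφ-scaled k ws)) (≈ᴹ-sym (*ₗ-distribˡ k _ _))

  f-term : ∀ k w → f [ (k , w) ] ≈ᴹ (k *ₗ φ w)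
  f-term k w = ≈ᴹ-trans (cong _ _ term≈scaled) (homog k (basis w))
    where
      term≈scaled : [ (k , w) ] ≈Ш (k •Ш basis w)
      term≈scaled w′ with does (w ≟W w′)
      ... | true  = K-+-congʳ (K-sym (K-*-identityʳ k))
      ... | false = K-refl

  f≈Lφ : ∀ e → f e ≈ᴹ Lφ e
  f≈Lφ []            = ≈ᴹ-trans (homog 0# []) (*ₗ-zeroˡ _)
  f≈Lφ ((k , w) ∷ e) =
    ≈ᴹ-trans (additive [ (k , w) ] e) (+ᴹ-cong (f-term k w) (f≈Lφ e))

  f-basis-product : ∀ u v → f (basis u ·Ш basis v) ≈ᴹ Σφ (mulW u v)
  f-basis-product u v = begin
    f (basis u ·Ш basis v)          ≈⟨ f≈Lφ _ ⟩
    Lφ ((terms ++ []) ++ [])        ≈⟨ ≈ᴹ-reflexive (Eq.cong Lφ (LP.++-identityʳ (terms ++ []))) ⟩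
    Lφ (terms ++ [])                ≈⟨ ≈ᴹ-reflexive (Eq.cong Lφ (LP.++-identityʳ terms)) ⟩
    Lφ terms                        ≈⟨ Lφ-scaled (1# *K 1#) (mulW u v) ⟩
    (1# *K 1#) *ₗ Σφ (mulW u v)     ≈⟨ *ₗ-cong (K-*-identityʳ 1#) ≈ᴹ-refl ⟩
    1# *ₗ Σφ (mulW u v)             ≈⟨ *ₗ-identityˡ _ ⟩
    Σφ (mulW u v)                   ∎
    where terms = map (λ w → (1# *K 1# , w)) (mulW u v)

  BasisMultiplicative : Set ℓm
  BasisMultiplicative = ∀ u v → Σφ (mulW u v) ≈ᴹ (φ u * φ v)

  row : Carrier → Word → Ш → Ш
  row k u z = concatMap (λ q → map (λ w → (k *K proj₁ q , w)) (mulW u (proj₂ q))) z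

  module _ (basis-mult : BasisMultiplicative) where

    Lφ-row : ∀ k u z → Lφ (row k u z) ≈ᴹ ((k *ₗ φ u) * Lφ z)
    Lφ-row k u []            = ≈ᴹ-sym (*-zero _)
    Lφ-row k u ((l , v) ∷ z) = begin
      Lφ (terms ++ rest)
        ≈⟨ Lφ-++ terms rest ⟩
      Lφ terms +ᴹ Lφ rest
        ≈⟨ +ᴹ-cong (Lφ-scaled (k *K l) (mulW u v)) (Lφ-row k u z) ⟩
      (k *K l) *ₗ Σφ (mulW u v) +ᴹ (k *ₗ φ u) * Lφ z
        ≈⟨ +ᴹ-congʳ (*ₗ-cong K-refl (basis-mult u v)) ⟩
      (k *K l) *ₗ (φ u * φ v) +ᴹ (k *ₗ φ u) * Lφ z
        ≈⟨ +ᴹ-congʳ (*ₗ-assoc k l _) ⟩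
      k *ₗ (l *ₗ (φ u * φ v)) +ᴹ (k *ₗ φ u) * Lφ z
        ≈⟨ +ᴹ-congʳ (*ₗ-cong K-refl (*-*ₗ l (φ u) (φ v))) ⟨
      k *ₗ (φ u * (l *ₗ φ v)) +ᴹ (k *ₗ φ u) * Lφ z
        ≈⟨ +ᴹ-congʳ (*ₗ-* k (φ u) (l *ₗ φ v)) ⟨
      (k *ₗ φ u) * (l *ₗ φ v) +ᴹ (k *ₗ φ u) * Lφ z
        ≈⟨ *-distribˡ _ _ _ ⟨
      (k *ₗ φ u) * (l *ₗ φ v +ᴹ Lφ z) ∎
      where
        terms = map (λ w → (k *K l , w)) (mulW u v)
        rest  = row k u z

    Lφ-product : ∀ y z → Lφ (y ·Ш z) ≈ᴹ (Lφ y * Lφ z)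
    Lφ-product []            z = ≈ᴹ-sym (zero-* _)
    Lφ-product ((k , u) ∷ y) z = begin
      Lφ (row k u z ++ (y ·Ш z))           ≈⟨ Lφ-++ (row k u z) (y ·Ш z) ⟩
      Lφ (row k u z) +ᴹ Lφ (y ·Ш z)        ≈⟨ +ᴹ-cong (Lφ-row k u z) (Lφ-product y z) ⟩
      (k *ₗ φ u) * Lφ z +ᴹ Lφ y * Lφ z     ≈⟨ *-distribʳ _ _ _ ⟨
      (k *ₗ φ u +ᴹ Lφ y) * Lφ z            ∎

    multiplicative : ∀ y z → f (y ·Ш z) ≈ᴹ (f y * f z)
    multiplicative y z = begin
      f (y ·Ш z)     ≈⟨ f≈Lφ _ ⟩
      Lφ (y ·Ш z)    ≈⟨ Lφ-product y z ⟩
      Lφ y * Lφ z    ≈⟨ *-cong (f≈Lφ y) (f≈Lφ z) ⟨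
      f y * f z      ∎

module BasisMultiplicativity {c ℓ m ℓm} (K : CommutativeRing c ℓ) (R : RBAlgebra K m ℓm)
  (f : Sha.Ш K → RBAlgebra.Carrierᴹ R)
  (lin : Sha.IsLinear K R f)
  (f-x· : ∀ y → RBAlgebra._≈ᴹ_ R (f (Sha._·Ш_ K (Sha.xШ K) y))
                 (RBAlgebra._*_ R (f (Sha.xШ K)) (f y)))
  (f-P : ∀ y → RBAlgebra._≈ᴹ_ R (f (Sha.Px K y)) (RBAlgebra.P R (f y))) where

  open Sha K using (_·Ш_)
  open RBAlgebra R
  open AlgebraProperties algebra
  open RBProperties R
  open LinearExtension K R f lin
  open SetoidReasoning ≈ᴹ-setoid

  φ-xmul : ∀ w → φ (xmul w) ≈ᴹ (φ xW * φ w)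
  φ-xmul w = begin
    φ (xmul w)                ≈⟨ Σφ-singleton (xmul w) ⟨
    Σφ [ xmul w ]             ≈⟨ ≈ᴹ-reflexive (Eq.cong Σφ (mulW-x-left w)) ⟨
    Σφ (mulW xW w)            ≈⟨ f-basis-product xW w ⟨
    f (basis xW ·Ш basis w)   ≈⟨ f-x· (basis w) ⟩
    φ xW * φ w                ∎

  Σφ-xmul : ∀ ws → Σφ (map xmul ws) ≈ᴹ (φ xW * Σφ ws)
  Σφ-xmul []       = ≈ᴹ-sym (*-zero _)
  Σφ-xmul (w ∷ ws) = ≈ᴹ-trans (+ᴹ-cong (φ-xmul w) (Σφ-xmul ws)) (≈ᴹ-sym (*-distribˡ _ _ _))

  φ-Px : ∀ w → φ (PxW w) ≈ᴹ P (φ w)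
  φ-Px w = f-P (basis w)

  Σφ-Px : ∀ ws → Σφ (map PxW ws) ≈ᴹ P (Σφ ws)
  Σφ-Px []       = ≈ᴹ-sym P-zero
  Σφ-Px (w ∷ ws) = ≈ᴹ-trans (+ᴹ-cong (φ-Px w) (Σφ-Px ws)) (≈ᴹ-sym (P-+ _ _))

  φ-mult : ∀ {u v} → Generated u → Generated v → Σφ (mulW u v) ≈ᴹ (φ u * φ v)
  φ-mult {v = v} gen-x _ = begin
    Σφ (mulW xW v)     ≈⟨ ≈ᴹ-reflexive (Eq.cong Σφ (mulW-x-left v)) ⟩
    Σφ [ xmul v ]      ≈⟨ Σφ-singleton (xmul v) ⟩
    φ (xmul v)         ≈⟨ φ-xmul v ⟩
    φ xW * φ v         ∎
  φ-mult {v = v} (gen-· {u} gu) gv = begin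
    Σφ (mulW (xmul u) v)      ≈⟨ ≈ᴹ-reflexive (Eq.cong Σφ (mulW-xmul-left u v)) ⟩
    Σφ (map xmul (mulW u v))  ≈⟨ Σφ-xmul (mulW u v) ⟩
    φ xW * Σφ (mulW u v)      ≈⟨ *-cong ≈ᴹ-refl (φ-mult gu gv) ⟩
    φ xW * (φ u * φ v)        ≈⟨ *-assoc _ _ _ ⟨
    (φ xW * φ u) * φ v        ≈⟨ *-cong (φ-xmul u) ≈ᴹ-refl ⟨
    φ (xmul u) * φ v          ∎
  φ-mult (gen-P {u} gu) gen-x = begin
    Σφ (mulW (PxW u) xW)      ≈⟨ ≈ᴹ-reflexive (Eq.cong Σφ (mulW-x-right-P u)) ⟩
    Σφ [ xmul (PxW u) ]       ≈⟨ Σφ-singleton _ ⟩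
    φ (xmul (PxW u))          ≈⟨ φ-xmul (PxW u) ⟩
    φ xW * φ (PxW u)          ≈⟨ *-comm _ _ ⟩
    φ (PxW u) * φ xW          ∎
  φ-mult (gen-P {u} gu) (gen-· {v} gv) = begin
    Σφ (mulW (PxW u) (xmul v))       ≈⟨ ≈ᴹ-reflexive (Eq.cong Σφ (mulW-xmul-right (PxW u) v)) ⟩
    Σφ (map xmul (mulW (PxW u) v))   ≈⟨ Σφ-xmul (mulW (PxW u) v) ⟩
    φ xW * Σφ (mulW (PxW u) v)       ≈⟨ *-cong ≈ᴹ-refl (φ-mult (gen-P gu) gv) ⟩
    φ xW * (φ (PxW u) * φ v)         ≈⟨ *-assoc _ _ _ ⟨
    (φ xW * φ (PxW u)) * φ v         ≈⟨ *-cong (*-comm _ _) ≈ᴹ-refl ⟩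
    (φ (PxW u) * φ xW) * φ v         ≈⟨ *-assoc _ _ _ ⟩
    φ (PxW u) * (φ xW * φ v)         ≈⟨ *-cong ≈ᴹ-refl (φ-xmul v) ⟨
    φ (PxW u) * φ (xmul v)           ∎
  φ-mult (gen-P {u} gu) (gen-P {v} gv) = begin
    Σφ (mulW (PxW u) (PxW v))
      ≈⟨ Σφ-↭ (mulW-RB u v) ⟩
    Σφ (map PxW (mulW u (PxW v)) ++ map PxW (mulW (PxW u) v))
      ≈⟨ Σφ-++ (map PxW (mulW u (PxW v))) (map PxW (mulW (PxW u) v)) ⟩
    Σφ (map PxW (mulW u (PxW v))) +ᴹ Σφ (map PxW (mulW (PxW u) v))
      ≈⟨ +ᴹ-cong (Σφ-Px (mulW u (PxW v))) (Σφ-Px (mulW (PxW u) v)) ⟩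
    P (Σφ (mulW u (PxW v))) +ᴹ P (Σφ (mulW (PxW u) v))
      ≈⟨ +ᴹ-cong (P-cong (φ-mult gu (gen-P gv))) (P-cong (φ-mult (gen-P gu) gv)) ⟩
    P (φ u * φ (PxW v)) +ᴹ P (φ (PxW u) * φ v)
      ≈⟨ +ᴹ-cong (P-cong (*-cong ≈ᴹ-refl (φ-Px v))) (P-cong (*-cong (φ-Px u) ≈ᴹ-refl)) ⟩
    P (φ u * P (φ v)) +ᴹ P (P (φ u) * φ v)
      ≈⟨ P-RB _ _ ⟨
    P (φ u) * P (φ v)
      ≈⟨ *-cong (φ-Px u) (φ-Px v) ⟨
    φ (PxW u) * φ (PxW v) ∎

  basis-multiplicative : BasisMultiplicative
  basis-multiplicative u v = φ-mult (generated u) (generated v)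

lemma4p5 : ∀ {c ℓ m ℓm} (K : CommutativeRing c ℓ) (R : RBAlgebra K m ℓm)
    (f : Sha.Ш K → RBAlgebra.Carrierᴹ R) →
    Sha.IsLinear K R f →
    (∀ y → RBAlgebra._≈ᴹ_ R (f (Sha._·Ш_ K (Sha.xШ K) y))
    (RBAlgebra._*_ R (f (Sha.xШ K)) (f y))) →
    (∀ y → RBAlgebra._≈ᴹ_ R (f (Sha.Px K y)) (RBAlgebra.P R (f y))) →
    Sha.IsRBHom K R f
lemma4p5 K R f lin f-x· f-P = record
  { linear = lin
  ; mult   = LinearExtension.multiplicative K R f lin
               (BasisMultiplicativity.basis-multiplicative K R f lin f-x· f-P)
  ; comm-P = f-P
  }
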